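{- Let $\ell$ be any prime and let $m,n\in\mathbb{N}$ satisfy $m\equiv n\pmod{\ell^s}$ for some $s\in\mathbb{N}$. Then $d_{t+1}(m)\equiv d_{t+1}(n)\pmod{\ell^{s-t}}$ for $t=0,1,\dots,s-1$.
   Context: For an integer $a\ge0$, $P_a(X)=2-2\,T_a\!\left(1-\frac{X}{2}\right)\in\mathbb{Z}[X]$, where $T_a$ is the Chebyshev polynomial of the first kind ($T_a(\cos\theta)=\cos(a\theta)$). Write $P_a(X)=\sum_{k=1}^{a}d_k(a)X^k$, and set $d_k(a)=0$ for $k>a$. Here $\mathbb{N}$ denotes the positive integers. -}

module Defs where

open import Data.Nat using (ℕ; zero; suc; _∸_; _^_)
open import Data.Integer using (ℤ; +_)
open import Data.Rational using (ℚ; 0ℚ; 1ℚ; ½; _+_; _*_; -_; _/_)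
open import Data.List using (List; []; _∷_)
open import Data.Product using (∃)
open import Relation.Binary.PropositionalEquality using (_≡_)

-- Polynomials with rational coefficients, as coefficient lists
-- (constant term first); missing coefficients are 0.
Poly : Set
Poly = List ℚ

infixl 6 _⊕_
_⊕_ : Poly → Poly → Poly
[] ⊕ q = q
(a ∷ p) ⊕ [] = a ∷ p
(a ∷ p) ⊕ (b ∷ q) = (a + b) ∷ (p ⊕ q)

scale : ℚ → Poly → Poly
scale c [] = []
scale c (a ∷ p) = (c * a) ∷ scale c p

shiftX : Poly → Poly
shiftX p = 0ℚ ∷ p

infixl 7 _⊗_
_⊗_ : Poly → Poly → Poly
[] ⊗ q = []
(a ∷ p) ⊗ q = scale a q ⊕ shiftX (p ⊗ q)

constP : ℚ → Poly
constP c = c ∷ []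

Xp : Poly
Xp = 0ℚ ∷ 1ℚ ∷ []

coeff : Poly → ℕ → ℚ
coeff [] k = 0ℚ
coeff (a ∷ p) zero = a
coeff (a ∷ p) (suc k) = coeff p k

cheb : ℕ → Poly
cheb zero = constP 1ℚ
cheb (suc zero) = Xp
cheb (suc (suc a)) = scale (+ 2 / 1) (Xp ⊗ cheb (suc a)) ⊕ scale (- 1ℚ) (cheb a)

compose : Poly → Poly → Poly
compose [] q = []
compose (a ∷ p) q = constP a ⊕ (q ⊗ compose p q)

oneMinusHalfX : Poly
oneMinusHalfX = 1ℚ ∷ (- ½) ∷ []

P : ℕ → Poly
P a = constP (+ 2 / 1) ⊕ scale (- (+ 2 / 1)) (compose (cheb a) oneMinusHalfX)

-- d_k(a) = coefficient of X^k in P_a (automatically 0 for k > a)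
d : ℕ → ℕ → ℚ
d k a = coeff (P a) k

_≡_[modℚ_] : ℚ → ℚ → ℕ → Set
x ≡ y [modℚ N ] = ∃ λ (q : ℤ) → x + (- y) ≡ (+ N / 1) * (q / 1)

{-# OPTIONS --safe #-}
-- The Chebyshev recurrence gives P_(a+2) = 2X + (2 - X) P_(a+1) - P_a, so the coefficients d_k(a)
-- are integers D k a whose second forward difference in a is Δ²D_(k+1)(a) = 2[k = 0] - D_k(a + 1).
-- Hence a ↦ D_(t+1)(a) is a polynomial of degree 2t + 2 with top difference ±2, and Newton's
-- formula writes D_(t+1)(n + h) - D_(t+1)(n) as the sum over i ≥ 1 of C(h, i) Δ^i D_(t+1)(n).
-- If ℓ^s ∣ h then ℓ^s ∣ i C(h, i) = h C(h - 1, i - 1). For i ≤ 2t + 1 we have i < ℓ^(t+1), so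
-- ℓ^(s-t) ∣ C(h, i); for i = 2(t + 1) we use t + 1 < ℓ^(t+1) and Δ^i D_(t+1) = ±2 instead;
-- for larger i the difference vanishes.
module Submission where

module PrimePowers where

  open import Data.Nat
  open import Data.Nat.Properties
  open import Data.Nat.Divisibility
  open import Data.Nat.Primality using (Prime; euclidsLemma; prime⇒nonZero)
  open import Data.Sum using (inj₁; inj₂)
  open import Relation.Nullary using (¬_; yes; no; contradiction)
  open import Relation.Binary.PropositionalEquality

  ^-monoʳ-∣ : ∀ p {m n} → m ≤ n → p ^ m ∣ p ^ n
  ^-monoʳ-∣ p {n = n} z≤n       = 1∣ (p ^ n)
  ^-monoʳ-∣ p         (s≤s m≤n) = *-monoʳ-∣ p (^-monoʳ-∣ p m≤n)

  [1+n]+[1+n]≤m^[1+n] : ∀ {m} → 2 ≤ m → ∀ n → suc n + suc n ≤ m ^ suc n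
  [1+n]+[1+n]≤m^[1+n] {m} 2≤m zero    = subst (2 ≤_) (sym (*-identityʳ m)) 2≤m
  [1+n]+[1+n]≤m^[1+n] {m} 2≤m (suc n) = begin
    suc (suc n) + suc (suc n)         ≡⟨ cong suc (+-suc (suc n) (suc n)) ⟩
    2 + (suc n + suc n)               ≤⟨ +-monoˡ-≤ (suc n + suc n) (+-mono-≤ (s≤s z≤n) (s≤s z≤n)) ⟩
    (suc n + suc n) + (suc n + suc n) ≤⟨ +-mono-≤ IH IH ⟩
    m ^ suc n + m ^ suc n             ≡⟨ cong (m ^ suc n +_) (+-identityʳ (m ^ suc n)) ⟨
    2 * m ^ suc n                     ≤⟨ *-monoˡ-≤ (m ^ suc n) 2≤m ⟩
    m ^ suc (suc n)                   ∎
    where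
    open ≤-Reasoning
    IH = [1+n]+[1+n]≤m^[1+n] 2≤m n

  module _ {p} (p-prime : Prime p) where

    private instance
      p≢0 : NonZero p
      p≢0 = prime⇒nonZero p-prime

    p^s∣m*n⇒p^s∣n : ∀ s {m n} → ¬ p ∣ m → p ^ s ∣ m * n → p ^ s ∣ n
    p^s∣m*n⇒p^s∣n zero    {n = n} _ _ = 1∣ n
    p^s∣m*n⇒p^s∣n (suc s) {m} {n} p∤m p^[1+s]∣mn
      with euclidsLemma m n p-prime (∣-trans (m∣m*n (p ^ s)) p^[1+s]∣mn)
    ... | inj₁ p∣m = contradiction p∣m p∤m
    ... | inj₂ (divides q refl) =
      subst (_∣ q * p) (*-comm (p ^ s) p) (*-monoˡ-∣ p (p^s∣m*n⇒p^s∣n s p∤m p^s∣mq))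
      where
      p^s∣mq : p ^ s ∣ m * q
      p^s∣mq = *-cancelʳ-∣ p (subst₂ _∣_ (*-comm p (p ^ s)) (sym (*-assoc m q p)) p^[1+s]∣mn)

    -- j < p ^ (1 + t) forces the p-adic valuation of j to be at most t.
    p^s∣j*n⇒p^[s∸t]∣n : ∀ s t {j n} → 0 < j → j < p ^ suc t → p ^ s ∣ j * n → p ^ (s ∸ t) ∣ n
    p^s∣j*n⇒p^[s∸t]∣n s t {j} 0<j j<p^[1+t] p^s∣jn with p ∣? j
    ... | no p∤j = ∣-trans (^-monoʳ-∣ p (m∸n≤m s t)) (p^s∣m*n⇒p^s∣n s p∤j p^s∣jn)
    p^s∣j*n⇒p^[s∸t]∣n s zero 0<j j<p p^s∣jn | yes (divides (suc q) refl) =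
      contradiction j<p (≤⇒≯ (subst (_≤ suc q * p) (sym (*-identityʳ p)) (m≤m+n p (q * p))))
    p^s∣j*n⇒p^[s∸t]∣n zero (suc t) {n = n} 0<j j<p^[1+t] p^s∣jn | yes (divides (suc q) refl) = 1∣ n
    p^s∣j*n⇒p^[s∸t]∣n (suc s) (suc t) {n = n} 0<j j<p^[1+t] p^s∣jn | yes (divides (suc q) refl) =
      p^s∣j*n⇒p^[s∸t]∣n s t z<s q<p^[1+t] (*-cancelˡ-∣ p (subst (p * p ^ s ∣_) qpn≡p[qn] p^s∣jn))
      where
      qpn≡p[qn] : suc q * p * n ≡ p * (suc q * n)
      qpn≡p[qn] = trans (cong (_* n) (*-comm (suc q) p)) (*-assoc p (suc q) n)
      q<p^[1+t] : suc q < p ^ suc t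
      q<p^[1+t] = *-cancelʳ-< p (suc q) (p ^ suc t) (subst (suc q * p <_) (*-comm p (p ^ suc t)) j<p^[1+t])

module Binomial where

  open import Data.Nat
  open import Data.Nat.Properties
  open import Data.Nat.Divisibility using (_∣_; ∣m⇒∣m*n; _∣0)
  open import Data.Nat.Combinatorics using (_C_; nC1≡n; nCk+nC[k+1]≡[n+1]C[k+1])
  open import Data.Nat.Tactic.RingSolver using (solve-∀)
  open import Relation.Binary.PropositionalEquality

  [1+k]*[1+n]C[1+k]≡[1+n]*nCk : ∀ n k → suc k * (suc n C suc k) ≡ suc n * (n C k)
  [1+k]*[1+n]C[1+k]≡[1+n]*nCk n zero =
    trans (*-identityˡ _) (trans (nC1≡n (suc n)) (sym (*-identityʳ (suc n))))
  [1+k]*[1+n]C[1+k]≡[1+n]*nCk zero (suc k) = *-zeroʳ (suc (suc k))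
  [1+k]*[1+n]C[1+k]≡[1+n]*nCk (suc n) (suc k) = begin
    suc (suc k) * (suc (suc n) C suc (suc k))
      ≡⟨ cong (suc (suc k) *_) (nCk+nC[k+1]≡[n+1]C[k+1] (suc n) (suc k)) ⟨
    suc (suc k) * (A + B)
      ≡⟨ split k A B ⟩
    A + (suc k * A + suc (suc k) * B)
      ≡⟨ cong₂ (λ u v → A + (u + v)) ([1+k]*[1+n]C[1+k]≡[1+n]*nCk n k)
                                     ([1+k]*[1+n]C[1+k]≡[1+n]*nCk n (suc k)) ⟩
    A + (suc n * (n C k) + suc n * (n C suc k))
      ≡⟨ cong (A +_) (*-distribˡ-+ (suc n) (n C k) (n C suc k)) ⟨
    A + suc n * (n C k + n C suc k)
      ≡⟨ cong (λ u → A + suc n * u) (nCk+nC[k+1]≡[n+1]C[k+1] n k) ⟩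
    suc (suc n) * A ∎
    where
    open ≡-Reasoning
    A = suc n C suc k
    B = suc n C suc (suc k)
    split : ∀ k a b → suc (suc k) * (a + b) ≡ a + (suc k * a + suc (suc k) * b)
    split = solve-∀

  d∣n⇒d∣[1+k]*nC[1+k] : ∀ {d} n k → d ∣ n → d ∣ suc k * (n C suc k)
  d∣n⇒d∣[1+k]*nC[1+k] {d} zero    k _   = subst (d ∣_) (sym (*-zeroʳ (suc k))) (d ∣0)
  d∣n⇒d∣[1+k]*nC[1+k] {d} (suc n) k d∣n =
    subst (d ∣_) (sym ([1+k]*[1+n]C[1+k]≡[1+n]*nCk n k)) (∣m⇒∣m*n (n C k) d∣n)

module FiniteDifferences where

  open import Data.Nat as ℕ using (ℕ; zero; suc; s≤s)
  import Data.Nat.Properties as ℕ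
  open import Data.Nat.Combinatorics using (_C_; nCk+nC[k+1]≡[n+1]C[k+1])
  open import Data.Fin using (Fin; toℕ)
  open import Data.Integer hiding (suc)
  open import Data.Integer.Properties hiding (suc-*)
  open import Data.Integer.Tactic.RingSolver using (solve-∀)
  open import Algebra.Properties.CommutativeMonoid.Sum +-0-commutativeMonoid
    using (sum; sum-syntax; ∑-distrib-+; sum-cong-≗; sum-replicate-zero)
  open import Relation.Binary.PropositionalEquality

  δ₀ : ℤ → ℕ → ℤ
  δ₀ c zero    = c
  δ₀ c (suc i) = 0ℤ

  Δ : (ℕ → ℤ) → ℕ → ℤ
  Δ f n = f (suc n) - f n

  Δ^ : ℕ → (ℕ → ℤ) → ℕ → ℤ
  Δ^ zero    f = f
  Δ^ (suc i) f = Δ^ i (Δ f)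

  Δ^-cong : ∀ i {f g} → (∀ n → f n ≡ g n) → ∀ n → Δ^ i f n ≡ Δ^ i g n
  Δ^-cong zero    f≗g = f≗g
  Δ^-cong (suc i) f≗g = Δ^-cong i (λ n → cong₂ _-_ (f≗g (suc n)) (f≗g n))

  Δ^-suc : ∀ i f n → Δ^ (suc i) f n ≡ Δ^ i f (suc n) - Δ^ i f n
  Δ^-suc zero    f n = refl
  Δ^-suc (suc i) f n = Δ^-suc i (Δ f) n

  Δ^-zero : ∀ i n → Δ^ i (λ _ → 0ℤ) n ≡ 0ℤ
  Δ^-zero zero    n = refl
  Δ^-zero (suc i) n = Δ^-zero i n

  δ₀-zero : ∀ i → δ₀ 0ℤ i ≡ 0ℤ
  δ₀-zero zero    = refl
  δ₀-zero (suc i) = refl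

  Δ^-const-minus-shift : ∀ i c g n → Δ^ i (λ m → c - g (suc m)) n ≡ δ₀ c i - Δ^ i g (suc n)
  Δ^-const-minus-shift zero    c g n = refl
  Δ^-const-minus-shift (suc i) c g n = begin
    Δ^ i (Δ (λ m → c - g (suc m))) n ≡⟨ Δ^-cong i (λ m → difference c (g (suc (suc m))) (g (suc m))) n ⟩
    Δ^ i (λ m → 0ℤ - Δ g (suc m)) n  ≡⟨ Δ^-const-minus-shift i 0ℤ (Δ g) n ⟩
    δ₀ 0ℤ i - Δ^ i (Δ g) (suc n)     ≡⟨ cong (_- Δ^ i (Δ g) (suc n)) (δ₀-zero i) ⟩
    0ℤ - Δ^ (suc i) g (suc n)        ∎
    where
    open ≡-Reasoning
    difference : ∀ c x y → (c - x) - (c - y) ≡ 0ℤ - (x - y)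
    difference = solve-∀

  -- Any range N > h may be summed over, as h C i = 0 for i > h; this lets the induction on h
  -- reuse the hypothesis at N and at suc N instead of splitting off a last term.
  newton : ∀ f n h N → h ℕ.< N →
           f (n ℕ.+ h) ≡ ∑[ i < N ] (+ (h C toℕ i) * Δ^ (toℕ i) f n)
  newton f n zero (suc N) _ = begin
    f (n ℕ.+ 0)   ≡⟨ cong f (ℕ.+-identityʳ n) ⟩
    f n           ≡⟨ *-identityˡ (f n) ⟨
    1ℤ * f n      ≡⟨ +-identityʳ (1ℤ * f n) ⟨
    1ℤ * f n + 0ℤ ≡⟨ cong (_+_ (1ℤ * f n)) (sum-replicate-zero N) ⟨
    1ℤ * f n + ∑[ i < N ] (+ (0 C suc (toℕ i)) * Δ^ (suc (toℕ i)) f n) ∎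
    where open ≡-Reasoning
  newton f n (suc h) (suc N) (s≤s h<N) = begin
    f (n ℕ.+ suc h)
      ≡⟨ cong f (ℕ.+-suc n h) ⟩
    f (suc n ℕ.+ h)
      ≡⟨ newton f (suc n) h N h<N ⟩
    ∑[ i < N ] (b (toℕ i) * Δ^ (toℕ i) f (suc n))
      ≡⟨ sum-cong-≗ {N} (λ i → shift (toℕ i)) ⟩
    ∑[ i < N ] (b (toℕ i) * Δ^ (toℕ i) f n + b (toℕ i) * Δ^ (suc (toℕ i)) f n)
      ≡⟨ ∑-distrib-+ u v ⟩
    ∑[ i < N ] (b (toℕ i) * Δ^ (toℕ i) f n) + S
      ≡⟨ cong (_+ S) (trans (sym (newton f n h N h<N)) (newton f n h (suc N) (ℕ.m<n⇒m<1+n h<N))) ⟩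
    (1ℤ * f n + T) + S
      ≡⟨ trans (+-assoc (1ℤ * f n) T S) (cong (_+_ (1ℤ * f n)) (+-comm T S)) ⟩
    1ℤ * f n + (S + T)
      ≡⟨ cong (_+_ (1ℤ * f n)) (∑-distrib-+ v w) ⟨
    1ℤ * f n + ∑[ i < N ] (b (toℕ i) * Δ^ (suc (toℕ i)) f n + b (suc (toℕ i)) * Δ^ (suc (toℕ i)) f n)
      ≡⟨ cong (_+_ (1ℤ * f n)) (sum-cong-≗ {N} (λ i → pascal (toℕ i))) ⟩
    1ℤ * f n + ∑[ i < N ] (+ (suc h C suc (toℕ i)) * Δ^ (suc (toℕ i)) f n) ∎
    where
    open ≡-Reasoning
    b : ℕ → ℤ
    b i = + (h C i)
    u v w : Fin N → ℤ
    u i = b (toℕ i) * Δ^ (toℕ i) f n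
    v i = b (toℕ i) * Δ^ (suc (toℕ i)) f n
    w i = b (suc (toℕ i)) * Δ^ (suc (toℕ i)) f n
    S = sum v
    T = sum w
    x≡y+[x-y] : ∀ x y → x ≡ y + (x - y)
    x≡y+[x-y] = solve-∀
    shift : ∀ i → b i * Δ^ i f (suc n) ≡ b i * Δ^ i f n + b i * Δ^ (suc i) f n
    shift i = begin
      b i * Δ^ i f (suc n)                              ≡⟨ cong (b i *_) (x≡y+[x-y] (Δ^ i f (suc n)) (Δ^ i f n)) ⟩
      b i * (Δ^ i f n + (Δ^ i f (suc n) - Δ^ i f n))    ≡⟨ cong (λ d → b i * (Δ^ i f n + d)) (Δ^-suc i f n) ⟨
      b i * (Δ^ i f n + Δ^ (suc i) f n)                 ≡⟨ *-distribˡ-+ (b i) _ _ ⟩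
      b i * Δ^ i f n + b i * Δ^ (suc i) f n             ∎
    pascal : ∀ i → b i * Δ^ (suc i) f n + b (suc i) * Δ^ (suc i) f n ≡ + (suc h C suc i) * Δ^ (suc i) f n
    pascal i = begin
      b i * E + b (suc i) * E   ≡⟨ *-distribʳ-+ E (b i) (b (suc i)) ⟨
      (b i + b (suc i)) * E     ≡⟨ cong (_* E) (pos-+ (h C i) (h C suc i)) ⟨
      + (h C i ℕ.+ h C suc i) * E ≡⟨ cong (λ c → + c * E) (nCk+nC[k+1]≡[n+1]C[k+1] h i) ⟩
      + (suc h C suc i) * E     ∎
      where E = Δ^ (suc i) f n

module IntegerEmbedding where

  open import Defs using (_≡_[modℚ_])
  open import Data.Integer as ℤ using (ℤ; +_)
  open import Data.Integer.Divisibility.Signed using (_∣_; divides)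
  open import Data.Integer.Tactic.RingSolver using (solve-∀)
  open import Data.Rational using (ℚ; _/_; _+_; _*_; -_; _-_; toℚᵘ)
  open import Data.Rational.Properties using (toℚᵘ-injective; toℚᵘ-fromℚᵘ; toℚᵘ-homo-+; toℚᵘ-homo-*; toℚᵘ-homo‿-; *-comm)
  import Data.Rational.Unnormalised as ℚᵘ
  import Data.Rational.Unnormalised.Properties as ℚᵘ
  open import Data.Product using (_,_)
  open import Relation.Binary.PropositionalEquality

  ι : ℤ → ℚ
  ι z = z / 1

  toℚᵘ-ι : ∀ z → toℚᵘ (ι z) ℚᵘ.≃ ℚᵘ.mkℚᵘ z 0
  toℚᵘ-ι z = toℚᵘ-fromℚᵘ (ℚᵘ.mkℚᵘ z 0)

  ι-+ : ∀ x y → ι (x ℤ.+ y) ≡ ι x + ι y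
  ι-+ x y = toℚᵘ-injective (begin
    toℚᵘ (ι (x ℤ.+ y))           ≈⟨ toℚᵘ-ι (x ℤ.+ y) ⟩
    ℚᵘ.mkℚᵘ (x ℤ.+ y) 0           ≈⟨ ℚᵘ.*≡* (sum-over-1 x y) ⟩
    ℚᵘ.mkℚᵘ x 0 ℚᵘ.+ ℚᵘ.mkℚᵘ y 0 ≈⟨ ℚᵘ.+-cong (toℚᵘ-ι x) (toℚᵘ-ι y) ⟨
    toℚᵘ (ι x) ℚᵘ.+ toℚᵘ (ι y)   ≈⟨ toℚᵘ-homo-+ (ι x) (ι y) ⟨
    toℚᵘ (ι x + ι y)             ∎)
    where
    open ℚᵘ.≃-Reasoning
    sum-over-1 : ∀ x y → (x ℤ.+ y) ℤ.* (+ 1 ℤ.* + 1) ≡ (x ℤ.* + 1 ℤ.+ y ℤ.* + 1) ℤ.* + 1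
    sum-over-1 = solve-∀

  ι-* : ∀ x y → ι (x ℤ.* y) ≡ ι x * ι y
  ι-* x y = toℚᵘ-injective (begin
    toℚᵘ (ι (x ℤ.* y))           ≈⟨ toℚᵘ-ι (x ℤ.* y) ⟩
    ℚᵘ.mkℚᵘ x 0 ℚᵘ.* ℚᵘ.mkℚᵘ y 0 ≈⟨ ℚᵘ.*-cong (toℚᵘ-ι x) (toℚᵘ-ι y) ⟨
    toℚᵘ (ι x) ℚᵘ.* toℚᵘ (ι y)   ≈⟨ toℚᵘ-homo-* (ι x) (ι y) ⟨
    toℚᵘ (ι x * ι y)             ∎)
    where open ℚᵘ.≃-Reasoning

  ι-neg : ∀ x → ι (ℤ.- x) ≡ - ι x
  ι-neg x = toℚᵘ-injective (begin
    toℚᵘ (ι (ℤ.- x))     ≈⟨ toℚᵘ-ι (ℤ.- x) ⟩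
    ℚᵘ.- ℚᵘ.mkℚᵘ x 0     ≈⟨ ℚᵘ.-‿cong (toℚᵘ-ι x) ⟨
    ℚᵘ.- toℚᵘ (ι x)      ≈⟨ toℚᵘ-homo‿- (ι x) ⟨
    toℚᵘ (- ι x)         ∎)
    where open ℚᵘ.≃-Reasoning

  ι-- : ∀ x y → ι (x ℤ.- y) ≡ ι x - ι y
  ι-- x y = trans (ι-+ x (ℤ.- y)) (cong (_+_ (ι x)) (ι-neg y))

  ∣-⇒≡[modℚ] : ∀ {N} x y → + N ∣ x ℤ.- y → ι x ≡ ι y [modℚ N ]
  ∣-⇒≡[modℚ] {N} x y (divides q x-y≡qN) = q , (begin
    ι x - ι y          ≡⟨ ι-- x y ⟨
    ι (x ℤ.- y)        ≡⟨ cong ι x-y≡qN ⟩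
    ι (q ℤ.* + N)      ≡⟨ ι-* q (+ N) ⟩
    ι q * ι (+ N)      ≡⟨ *-comm (ι q) (ι (+ N)) ⟩
    ι (+ N) * ι q      ∎)
    where open ≡-Reasoning

module PolynomialCoefficients where

  open import Defs
  open import Data.Nat using (zero; suc)
  open import Data.Rational using (ℚ; 0ℚ; 1ℚ; _+_; _*_)
  open import Data.Rational.Properties using (+-identityˡ; +-identityʳ; *-zeroʳ)
  open import Data.Rational.Solver using (module +-*-Solver)
  open import Data.List using ([]; _∷_)
  open import Relation.Binary.PropositionalEquality
  open +-*-Solver

  coeff-⊕ : ∀ p q k → coeff (p ⊕ q) k ≡ coeff p k + coeff q k
  coeff-⊕ []      q       k       = sym (+-identityˡ (coeff q k))
  coeff-⊕ (a ∷ p) []      k       = sym (+-identityʳ (coeff (a ∷ p) k))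
  coeff-⊕ (a ∷ p) (b ∷ q) zero    = refl
  coeff-⊕ (a ∷ p) (b ∷ q) (suc k) = coeff-⊕ p q k

  coeff-scale : ∀ c p k → coeff (scale c p) k ≡ c * coeff p k
  coeff-scale c []      k       = sym (*-zeroʳ c)
  coeff-scale c (a ∷ p) zero    = refl
  coeff-scale c (a ∷ p) (suc k) = coeff-scale c p k

  coeff-shiftX-+ : ∀ {r p q} → (∀ k → coeff r k ≡ coeff p k + coeff q k) →
                   ∀ k → coeff (shiftX r) k ≡ coeff (shiftX p) k + coeff (shiftX q) k
  coeff-shiftX-+ r≗p+q zero    = sym (+-identityˡ 0ℚ)
  coeff-shiftX-+ r≗p+q (suc k) = r≗p+q k

  coeff-shiftX-* : ∀ {r p} c → (∀ k → coeff r k ≡ c * coeff p k) →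
                   ∀ k → coeff (shiftX r) k ≡ c * coeff (shiftX p) k
  coeff-shiftX-* c r≗cp zero    = sym (*-zeroʳ c)
  coeff-shiftX-* c r≗cp (suc k) = r≗cp k

  coeff-zero : ∀ k → coeff (constP 0ℚ) k ≡ 0ℚ
  coeff-zero zero    = refl
  coeff-zero (suc k) = refl

  coeff-linear-⊗ : ∀ a b q k → coeff ((a ∷ b ∷ []) ⊗ q) k ≡ a * coeff q k + b * coeff (shiftX q) k
  coeff-linear-⊗ a b q k = begin
    coeff (scale a q ⊕ shiftX (scale b q ⊕ shiftX [])) k
      ≡⟨ coeff-⊕ (scale a q) _ k ⟩
    coeff (scale a q) k + coeff (shiftX (scale b q ⊕ shiftX [])) k
      ≡⟨ cong₂ _+_ (coeff-scale a q k) (coeff-shiftX-* b b·q k) ⟩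
    a * coeff q k + b * coeff (shiftX q) k ∎
    where
    open ≡-Reasoning
    b·q : ∀ k → coeff (scale b q ⊕ constP 0ℚ) k ≡ b * coeff q k
    b·q k = begin
      coeff (scale b q ⊕ constP 0ℚ) k         ≡⟨ coeff-⊕ (scale b q) (constP 0ℚ) k ⟩
      coeff (scale b q) k + coeff (constP 0ℚ) k ≡⟨ cong₂ _+_ (coeff-scale b q k) (coeff-zero k) ⟩
      b * coeff q k + 0ℚ                       ≡⟨ +-identityʳ _ ⟩
      b * coeff q k                            ∎

  module LinearSubstitution (a b : ℚ) where

    private
      y : Poly
      y = a ∷ b ∷ []

    coeff-compose-∷ : ∀ e p k → coeff (compose (e ∷ p) y) k ≡
                      coeff (constP e) k + (a * coeff (compose p y) k + b * coeff (shiftX (compose p y)) k)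
    coeff-compose-∷ e p k = trans (coeff-⊕ (constP e) (y ⊗ compose p y) k)
                                  (cong (coeff (constP e) k +_) (coeff-linear-⊗ a b (compose p y) k))

    coeff-compose-⊕ : ∀ p q k → coeff (compose (p ⊕ q) y) k ≡ coeff (compose p y) k + coeff (compose q y) k
    coeff-compose-⊕ []      q       k = sym (+-identityˡ _)
    coeff-compose-⊕ (e ∷ p) []      k = sym (+-identityʳ _)
    coeff-compose-⊕ (e ∷ p) (f ∷ q) k = begin
      coeff (compose ((e + f) ∷ (p ⊕ q)) y) k
        ≡⟨ coeff-compose-∷ (e + f) (p ⊕ q) k ⟩
      coeff (constP e ⊕ constP f) k + (a * coeff (compose (p ⊕ q) y) k + b * coeff (shiftX (compose (p ⊕ q) y)) k)
        ≡⟨ cong₂ _+_ (coeff-⊕ (constP e) (constP f) k)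
                     (cong₂ (λ u v → a * u + b * v) (coeff-compose-⊕ p q k) (coeff-shiftX-+ (coeff-compose-⊕ p q) k)) ⟩
      (e′ + f′) + (a * (p′ + q′) + b * (Xp′ + Xq′))
        ≡⟨ solve 8 (λ e′ f′ a b p′ q′ Xp′ Xq′ →
                      (e′ :+ f′) :+ (a :* (p′ :+ q′) :+ b :* (Xp′ :+ Xq′))
                   := (e′ :+ (a :* p′ :+ b :* Xp′)) :+ (f′ :+ (a :* q′ :+ b :* Xq′)))
                 refl e′ f′ a b p′ q′ Xp′ Xq′ ⟩
      (e′ + (a * p′ + b * Xp′)) + (f′ + (a * q′ + b * Xq′))
        ≡⟨ cong₂ _+_ (coeff-compose-∷ e p k) (coeff-compose-∷ f q k) ⟨
      coeff (compose (e ∷ p) y) k + coeff (compose (f ∷ q) y) k ∎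
      where
      open ≡-Reasoning
      e′ = coeff (constP e) k
      f′ = coeff (constP f) k
      p′ = coeff (compose p y) k
      q′ = coeff (compose q y) k
      Xp′ = coeff (shiftX (compose p y)) k
      Xq′ = coeff (shiftX (compose q y)) k

    coeff-compose-scale : ∀ c p k → coeff (compose (scale c p) y) k ≡ c * coeff (compose p y) k
    coeff-compose-scale c []      k = sym (*-zeroʳ c)
    coeff-compose-scale c (e ∷ p) k = begin
      coeff (compose ((c * e) ∷ scale c p) y) k
        ≡⟨ coeff-compose-∷ (c * e) (scale c p) k ⟩
      coeff (scale c (constP e)) k + (a * coeff (compose (scale c p) y) k + b * coeff (shiftX (compose (scale c p) y)) k)
        ≡⟨ cong₂ _+_ (coeff-scale c (constP e) k)
                     (cong₂ (λ u v → a * u + b * v) (coeff-compose-scale c p k) (coeff-shiftX-* c (coeff-compose-scale c p) k)) ⟩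
      c * e′ + (a * (c * p′) + b * (c * Xp′))
        ≡⟨ solve 6 (λ c e′ a b p′ Xp′ → c :* e′ :+ (a :* (c :* p′) :+ b :* (c :* Xp′))
                                      := c :* (e′ :+ (a :* p′ :+ b :* Xp′)))
                 refl c e′ a b p′ Xp′ ⟩
      c * (e′ + (a * p′ + b * Xp′))
        ≡⟨ cong (c *_) (coeff-compose-∷ e p k) ⟨
      c * coeff (compose (e ∷ p) y) k ∎
      where
      open ≡-Reasoning
      e′ = coeff (constP e) k
      p′ = coeff (compose p y) k
      Xp′ = coeff (shiftX (compose p y)) k

    coeff-compose-X⊗ : ∀ p k → coeff (compose (Xp ⊗ p) y) k ≡ a * coeff (compose p y) k + b * coeff (shiftX (compose p y)) k
    coeff-compose-X⊗ p k = begin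
      coeff (compose (scale 0ℚ p ⊕ (0ℚ ∷ r)) y) k
        ≡⟨ coeff-compose-⊕ (scale 0ℚ p) (0ℚ ∷ r) k ⟩
      coeff (compose (scale 0ℚ p) y) k + coeff (compose (0ℚ ∷ r) y) k
        ≡⟨ cong₂ _+_ (coeff-compose-scale 0ℚ p k) (coeff-compose-∷ 0ℚ r k) ⟩
      0ℚ * p′ + (coeff (constP 0ℚ) k + (a * coeff (compose r y) k + b * coeff (shiftX (compose r y)) k))
        ≡⟨ cong₂ (λ z v → 0ℚ * p′ + (z + v)) (coeff-zero k)
                 (cong₂ (λ u v → a * u + b * v) (r≗1·p k) (coeff-shiftX-* 1ℚ r≗1·p k)) ⟩
      0ℚ * p′ + (0ℚ + (a * (1ℚ * p′) + b * (1ℚ * Xp′)))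
        ≡⟨ solve 4 (λ a b p′ Xp′ → con 0ℚ :* p′ :+ (con 0ℚ :+ (a :* (con 1ℚ :* p′) :+ b :* (con 1ℚ :* Xp′)))
                                 := a :* p′ :+ b :* Xp′)
                 refl a b p′ Xp′ ⟩
      a * p′ + b * Xp′ ∎
      where
      open ≡-Reasoning
      r = scale 1ℚ p ⊕ constP 0ℚ
      p′ = coeff (compose p y) k
      Xp′ = coeff (shiftX (compose p y)) k
      compose-zero : ∀ k → coeff (compose (constP 0ℚ) y) k ≡ 0ℚ
      compose-zero zero          = refl
      compose-zero (suc zero)    = refl
      compose-zero (suc (suc k)) = refl
      r≗1·p : ∀ k → coeff (compose r y) k ≡ 1ℚ * coeff (compose p y) k
      r≗1·p k = begin
        coeff (compose r y) k                                    ≡⟨ coeff-compose-⊕ (scale 1ℚ p) (constP 0ℚ) k ⟩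
        coeff (compose (scale 1ℚ p) y) k + coeff (compose (constP 0ℚ) y) k
          ≡⟨ cong₂ _+_ (coeff-compose-scale 1ℚ p k) (compose-zero k) ⟩
        1ℚ * coeff (compose p y) k + 0ℚ                          ≡⟨ +-identityʳ _ ⟩
        1ℚ * coeff (compose p y) k                               ∎

module ChebyshevCoefficients where

  open import Defs
  open import Data.Nat using (ℕ; zero; suc; _+_; _<_; _≤_; s≤s)
  open import Data.Nat.Properties using (+-suc)
  open import Data.Integer as ℤ using (ℤ; +_; 0ℤ; 1ℤ; ∣_∣)
  open import Data.Integer.Properties using (+-identityˡ; ∣-i∣≡∣i∣)
  open import Data.Integer.Tactic.RingSolver using (solve-∀)
  open import Data.Rational using (ℚ; 0ℚ; 1ℚ; ½; _*_; -_; _-_) renaming (_+_ to _+ℚ_)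
  open import Data.Rational.Solver using (module +-*-Solver)
  open import Relation.Nullary using (contradiction)
  open import Relation.Binary.PropositionalEquality
  open FiniteDifferences using (δ₀; Δ; Δ^; Δ^-cong; Δ^-zero; Δ^-const-minus-shift)
  open IntegerEmbedding using (ι; ι-+; ι-*; ι--)
  open PolynomialCoefficients using (coeff-⊕; coeff-scale; module LinearSubstitution)
  open LinearSubstitution 1ℚ (- ½)
  open +-*-Solver

  2ℚ : ℚ
  2ℚ = ι (+ 2)

  T′ : ℕ → ℕ → ℚ
  T′ a k = coeff (compose (cheb a) oneMinusHalfX) k

  T′-rec : ∀ a k → T′ (suc (suc a)) k ≡
           2ℚ * (1ℚ * T′ (suc a) k +ℚ (- ½) * coeff (shiftX (compose (cheb (suc a)) oneMinusHalfX)) k) +ℚ (- 1ℚ) * T′ a k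
  T′-rec a k = trans (coeff-compose-⊕ (scale 2ℚ (Xp ⊗ cheb (suc a))) (scale (- 1ℚ) (cheb a)) k)
    (cong₂ _+ℚ_ (trans (coeff-compose-scale 2ℚ (Xp ⊗ cheb (suc a)) k) (cong (2ℚ *_) (coeff-compose-X⊗ (cheb (suc a)) k)))
                (coeff-compose-scale (- 1ℚ) (cheb a) k))

  d≡2-2T′ : ∀ k a → d k a ≡ coeff (constP 2ℚ) k +ℚ (- 2ℚ) * T′ a k
  d≡2-2T′ k a = trans (coeff-⊕ (constP 2ℚ) (scale (- 2ℚ) Ta) k) (cong (_+ℚ_ (coeff (constP 2ℚ) k)) (coeff-scale (- 2ℚ) Ta k))
    where Ta = compose (cheb a) oneMinusHalfX

  d-rec-zero : ∀ a → d 0 (suc (suc a)) ≡ 2ℚ * d 0 (suc a) - d 0 a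
  d-rec-zero a = begin
    d 0 (suc (suc a))
      ≡⟨ d≡2-2T′ 0 (suc (suc a)) ⟩
    2ℚ +ℚ (- 2ℚ) * T′ (suc (suc a)) 0
      ≡⟨ cong (λ u → 2ℚ +ℚ (- 2ℚ) * u) (T′-rec a 0) ⟩
    2ℚ +ℚ (- 2ℚ) * (2ℚ * (1ℚ * A +ℚ (- ½) * 0ℚ) +ℚ (- 1ℚ) * B)
      ≡⟨ solve 2 (λ A B → con 2ℚ :+ con (- 2ℚ) :* (con 2ℚ :* (con 1ℚ :* A :+ con (- ½) :* con 0ℚ) :+ con (- 1ℚ) :* B)
                        := con 2ℚ :* (con 2ℚ :+ con (- 2ℚ) :* A) :- (con 2ℚ :+ con (- 2ℚ) :* B))
               refl A B ⟩
    2ℚ * (2ℚ +ℚ (- 2ℚ) * A) - (2ℚ +ℚ (- 2ℚ) * B)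
      ≡⟨ cong₂ (λ u v → 2ℚ * u - v) (d≡2-2T′ 0 (suc a)) (d≡2-2T′ 0 a) ⟨
    2ℚ * d 0 (suc a) - d 0 a ∎
    where
    open ≡-Reasoning
    A = T′ (suc a) 0
    B = T′ a 0

  d-rec-suc : ∀ k a → d (suc k) (suc (suc a)) ≡ 2ℚ * d (suc k) (suc a) - d k (suc a) - d (suc k) a +ℚ coeff (constP 2ℚ) k
  d-rec-suc k a = begin
    d (suc k) (suc (suc a))
      ≡⟨ d≡2-2T′ (suc k) (suc (suc a)) ⟩
    0ℚ +ℚ (- 2ℚ) * T′ (suc (suc a)) (suc k)
      ≡⟨ cong (λ u → 0ℚ +ℚ (- 2ℚ) * u) (T′-rec a (suc k)) ⟩
    0ℚ +ℚ (- 2ℚ) * (2ℚ * (1ℚ * A +ℚ (- ½) * B) +ℚ (- 1ℚ) * C)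
      ≡⟨ solve 4 (λ A B C c → con 0ℚ :+ con (- 2ℚ) :* (con 2ℚ :* (con 1ℚ :* A :+ con (- ½) :* B) :+ con (- 1ℚ) :* C)
                          := con 2ℚ :* (con 0ℚ :+ con (- 2ℚ) :* A) :- (c :+ con (- 2ℚ) :* B) :- (con 0ℚ :+ con (- 2ℚ) :* C) :+ c)
               refl A B C c ⟩
    2ℚ * (0ℚ +ℚ (- 2ℚ) * A) - (c +ℚ (- 2ℚ) * B) - (0ℚ +ℚ (- 2ℚ) * C) +ℚ c
      ≡⟨ cong₂ (λ u v → 2ℚ * u - v - (0ℚ +ℚ (- 2ℚ) * C) +ℚ c) (d≡2-2T′ (suc k) (suc a)) (d≡2-2T′ k (suc a)) ⟨
    2ℚ * d (suc k) (suc a) - d k (suc a) - (0ℚ +ℚ (- 2ℚ) * C) +ℚ c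
      ≡⟨ cong (λ u → 2ℚ * d (suc k) (suc a) - d k (suc a) - u +ℚ c) (d≡2-2T′ (suc k) a) ⟨
    2ℚ * d (suc k) (suc a) - d k (suc a) - d (suc k) a +ℚ c ∎
    where
    open ≡-Reasoning
    A = T′ (suc a) (suc k)
    B = T′ (suc a) k
    C = T′ a (suc k)
    c = coeff (constP 2ℚ) k

  -- The recursion of d_(k+1) in d-rec-suc, read over ℤ.
  D : ℕ → ℕ → ℤ
  D zero    a             = 0ℤ
  D (suc k) zero          = 0ℤ
  D (suc k) (suc zero)    = δ₀ 1ℤ k
  D (suc k) (suc (suc a)) = + 2 ℤ.* D (suc k) (suc a) ℤ.- D k (suc a) ℤ.- D (suc k) a ℤ.+ δ₀ (+ 2) k

  d≡ιD : ∀ k a → d k a ≡ ι (D k a)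
  d≡ιD zero                zero       = refl
  d≡ιD (suc zero)          zero       = refl
  d≡ιD (suc (suc k))       zero       = refl
  d≡ιD zero                (suc zero) = refl
  d≡ιD (suc zero)          (suc zero) = refl
  d≡ιD (suc (suc zero))    (suc zero) = refl
  d≡ιD (suc (suc (suc k))) (suc zero) = refl
  d≡ιD zero (suc (suc a)) =
    trans (d-rec-zero a) (cong₂ (λ u v → 2ℚ * u - v) (d≡ιD 0 (suc a)) (d≡ιD 0 a))
  d≡ιD (suc k) (suc (suc a)) = begin
    d (suc k) (suc (suc a))
      ≡⟨ d-rec-suc k a ⟩
    2ℚ * d (suc k) (suc a) - d k (suc a) - d (suc k) a +ℚ coeff (constP 2ℚ) k
      ≡⟨ cong₂ _+ℚ_ (cong₂ _-_ (cong₂ _-_ (cong (2ℚ *_) (d≡ιD (suc k) (suc a))) (d≡ιD k (suc a))) (d≡ιD (suc k) a))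
                    (ι-δ₀ k) ⟩
    2ℚ * ι X - ι Y - ι Z +ℚ ι (δ₀ (+ 2) k)
      ≡⟨ ι-step ⟨
    ι (D (suc k) (suc (suc a))) ∎
    where
    open ≡-Reasoning
    X = D (suc k) (suc a)
    Y = D k (suc a)
    Z = D (suc k) a
    ι-δ₀ : ∀ k → coeff (constP 2ℚ) k ≡ ι (δ₀ (+ 2) k)
    ι-δ₀ zero    = refl
    ι-δ₀ (suc k) = refl
    ι-step : ι (+ 2 ℤ.* X ℤ.- Y ℤ.- Z ℤ.+ δ₀ (+ 2) k) ≡ 2ℚ * ι X - ι Y - ι Z +ℚ ι (δ₀ (+ 2) k)
    ι-step = begin
      ι (+ 2 ℤ.* X ℤ.- Y ℤ.- Z ℤ.+ δ₀ (+ 2) k)    ≡⟨ ι-+ (+ 2 ℤ.* X ℤ.- Y ℤ.- Z) (δ₀ (+ 2) k) ⟩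
      ι (+ 2 ℤ.* X ℤ.- Y ℤ.- Z) +ℚ ι (δ₀ (+ 2) k) ≡⟨ cong (_+ℚ ι (δ₀ (+ 2) k)) (ι-- (+ 2 ℤ.* X ℤ.- Y) Z) ⟩
      ι (+ 2 ℤ.* X ℤ.- Y) - ι Z +ℚ ι (δ₀ (+ 2) k) ≡⟨ cong (λ u → u - ι Z +ℚ ι (δ₀ (+ 2) k)) (ι-- (+ 2 ℤ.* X) Y) ⟩
      ι (+ 2 ℤ.* X) - ι Y - ι Z +ℚ ι (δ₀ (+ 2) k) ≡⟨ cong (λ u → u - ι Y - ι Z +ℚ ι (δ₀ (+ 2) k)) (ι-* (+ 2) X) ⟩
      2ℚ * ι X - ι Y - ι Z +ℚ ι (δ₀ (+ 2) k)      ∎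

  Δ²D : ∀ k n → Δ (Δ (D (suc k))) n ≡ δ₀ (+ 2) k ℤ.- D k (suc n)
  Δ²D k n = second-difference (D (suc k) (suc n)) (D k (suc n)) (D (suc k) n) (δ₀ (+ 2) k)
    where
    second-difference : ∀ x w z c → ((+ 2 ℤ.* x ℤ.- w ℤ.- z ℤ.+ c) ℤ.- x) ℤ.- (x ℤ.- z) ≡ c ℤ.- w
    second-difference = solve-∀

  Δ^-D : ∀ i k n → Δ^ (suc (suc i)) (D (suc k)) n ≡ δ₀ (δ₀ (+ 2) k) i ℤ.- Δ^ i (D k) (suc n)
  Δ^-D i k n = trans (Δ^-cong i (Δ²D k) n) (Δ^-const-minus-shift i (δ₀ (+ 2) k) (D k) n)

  ∣Δ^[2+2k]D[1+k]∣≡2 : ∀ k n → ∣ Δ^ (suc k + suc k) (D (suc k)) n ∣ ≡ 2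
  ∣Δ^[2+2k]D[1+k]∣≡2 zero    n = cong ∣_∣ (Δ^-D 0 0 n)
  ∣Δ^[2+2k]D[1+k]∣≡2 (suc k) n = begin
    ∣ Δ^ (suc (suc (k + suc (suc k)))) (D (suc (suc k))) n ∣
      ≡⟨ cong (λ j → ∣ Δ^ (suc (suc j)) (D (suc (suc k))) n ∣) (+-suc k (suc k)) ⟩
    ∣ Δ^ (suc (suc (suc k + suc k))) (D (suc (suc k))) n ∣
      ≡⟨ cong ∣_∣ (trans (Δ^-D (suc k + suc k) (suc k) n) (+-identityˡ (ℤ.- top))) ⟩
    ∣ ℤ.- top ∣
      ≡⟨ ∣-i∣≡∣i∣ top ⟩
    ∣ top ∣
      ≡⟨ ∣Δ^[2+2k]D[1+k]∣≡2 k (suc n) ⟩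
    2 ∎
    where
    open ≡-Reasoning
    top = Δ^ (suc k + suc k) (D (suc k)) (suc n)

  Δ^D[k]≡0 : ∀ k i n → k + k < i → Δ^ i (D k) n ≡ 0ℤ
  Δ^D[k]≡0 zero    (suc i)             n _ = Δ^-zero (suc i) n
  Δ^D[k]≡0 (suc k) (suc (suc zero))    n (s≤s (s≤s k+[1+k]≤0)) =
    contradiction (subst (_≤ 0) (+-suc k k) k+[1+k]≤0) λ ()
  Δ^D[k]≡0 (suc k) (suc (suc (suc i))) n (s≤s (s≤s k+[1+k]≤1+i)) =
    trans (Δ^-D (suc i) k n) (cong (ℤ._-_ 0ℤ) (Δ^D[k]≡0 k (suc i) (suc n) (subst (_≤ suc i) (+-suc k k) k+[1+k]≤1+i)))

module Congruence where

  open import Data.Nat as ℕ using (zero; suc; _+_; _*_; _^_; _∸_; _≤_; s≤s; z≤n)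
  import Data.Nat.Properties as ℕ
  open import Data.Nat.Divisibility using (_∣_; _∣0; ∣m⇒∣m*n)
  open import Data.Nat.Primality using (Prime; prime⇒nonTrivial)
  open import Data.Nat.Combinatorics using (_C_)
  open import Data.Nat.Tactic.RingSolver as ℕ-Solver using ()
  open import Data.Fin using (Fin; zero; suc; toℕ)
  open import Data.Integer as ℤ using (ℤ; +_; 0ℤ; 1ℤ; ∣_∣)
  import Data.Integer.Properties as ℤ
  import Data.Integer.Divisibility as ℤᵘ
  import Data.Integer.Divisibility.Signed as ℤˢ
  open import Data.Integer.Tactic.RingSolver as ℤ-Solver using ()
  open import Algebra.Properties.CommutativeMonoid.Sum ℤ.+-0-commutativeMonoid using (sum; sum-syntax)
  open import Data.Sum using (inj₁; inj₂)
  open import Relation.Binary.Definitions using (tri<; tri≈; tri>)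
  open import Relation.Binary.PropositionalEquality
  open PrimePowers using ([1+n]+[1+n]≤m^[1+n]; p^s∣j*n⇒p^[s∸t]∣n)
  open Binomial using (d∣n⇒d∣[1+k]*nC[1+k])
  open FiniteDifferences using (Δ^; newton)
  open ChebyshevCoefficients using (D; ∣Δ^[2+2k]D[1+k]∣≡2; Δ^D[k]≡0)

  ∣-∑ : ∀ {d N} (g : Fin N → ℤ) → (∀ i → d ℤˢ.∣ g i) → d ℤˢ.∣ sum g
  ∣-∑ {N = zero}  g d∣g = ℤˢ.divides 0ℤ refl
  ∣-∑ {N = suc N} g d∣g = ℤˢ.∣m∣n⇒∣m+n (d∣g zero) (∣-∑ (λ i → g (suc i)) (λ i → d∣g (suc i)))

  ∣[+m]-[+n]∣≡m∸n : ∀ {m n} → n ≤ m → ∣ + m ℤ.- + n ∣ ≡ m ∸ n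
  ∣[+m]-[+n]∣≡m∸n {m} {n} n≤m =
    trans (cong ∣_∣ (ℤ.[+m]-[+n]≡m⊖n m n)) (trans (ℤ.∣m⊖n∣≡∣n⊖m∣ m n) (ℤ.∣⊖∣-≤ n≤m))

  module _ {p} (p-prime : Prime p) where

    private
      bound : ∀ t → suc t + suc t ≤ p ^ suc t
      bound = [1+n]+[1+n]≤m^[1+n] (ℕ.nonTrivial⇒n>1 p {{prime⇒nonTrivial p-prime}})

    p^[s∸t]∣hC[1+j]*∣Δ^[1+j]D[1+t]∣ : ∀ s t {h} n j → p ^ s ∣ h →
                                      p ^ (s ∸ t) ∣ (h C suc j) * ∣ Δ^ (suc j) (D (suc t)) n ∣
    p^[s∸t]∣hC[1+j]*∣Δ^[1+j]D[1+t]∣ s t {h} n j p^s∣h with ℕ.<-cmp (suc j) (suc t + suc t)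
    ... | tri< j<2+2t _ _ =
      p^s∣j*n⇒p^[s∸t]∣n p-prime s t (s≤s z≤n) (ℕ.<-≤-trans j<2+2t (bound t))
        (subst (p ^ s ∣_) (ℕ.*-assoc (suc j) B E) (∣m⇒∣m*n E p^s∣[1+j]B))
      where
      B = h C suc j
      E = ∣ Δ^ (suc j) (D (suc t)) n ∣
      p^s∣[1+j]B : p ^ s ∣ suc j * B
      p^s∣[1+j]B = d∣n⇒d∣[1+k]*nC[1+k] h j p^s∣h
    ... | tri≈ _ refl _ =
      subst (λ e → p ^ (s ∸ t) ∣ B * e) (sym (∣Δ^[2+2k]D[1+k]∣≡2 t n))
        (p^s∣j*n⇒p^[s∸t]∣n p-prime s t (s≤s z≤n) (ℕ.<-≤-trans (ℕ.m<m+n (suc t) (s≤s z≤n)) (bound t))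
          (subst (p ^ s ∣_) (halve t B) (d∣n⇒d∣[1+k]*nC[1+k] h j p^s∣h)))
      where
      B = h C (suc t + suc t)
      halve : ∀ t b → (suc t + suc t) * b ≡ suc t * (b * 2)
      halve = ℕ-Solver.solve-∀
    ... | tri> _ _ 2+2t<j =
      subst (λ e → p ^ (s ∸ t) ∣ (h C suc j) * ∣ e ∣) (sym (Δ^D[k]≡0 (suc t) (suc j) n 2+2t<j))
        (subst (p ^ (s ∸ t) ∣_) (sym (ℕ.*-zeroʳ (h C suc j))) ((p ^ (s ∸ t)) ∣0))

    D-congruence-+ : ∀ s t n h → p ^ s ∣ h → + (p ^ (s ∸ t)) ℤˢ.∣ D (suc t) (n ℕ.+ h) ℤ.- D (suc t) n
    D-congruence-+ s t n h p^s∣h = subst (+ (p ^ (s ∸ t)) ℤˢ.∣_) (sym newton-difference) (∣-∑ _ term)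
      where
      f = D (suc t)
      term : ∀ (i : Fin h) → + (p ^ (s ∸ t)) ℤˢ.∣ + (h C suc (toℕ i)) ℤ.* Δ^ (suc (toℕ i)) f n
      term i = ℤˢ.∣ᵤ⇒∣ (subst (p ^ (s ∸ t) ∣_) (sym (ℤ.abs-* (+ (h C suc (toℕ i))) _))
                                (p^[s∸t]∣hC[1+j]*∣Δ^[1+j]D[1+t]∣ s t n (toℕ i) p^s∣h))
      cancel : ∀ x y → (1ℤ ℤ.* x ℤ.+ y) ℤ.- x ≡ y
      cancel = ℤ-Solver.solve-∀
      newton-difference : f (n ℕ.+ h) ℤ.- f n ≡ ∑[ i < h ] (+ (h C suc (toℕ i)) ℤ.* Δ^ (suc (toℕ i)) f n)
      newton-difference = trans (cong (ℤ._- f n) (newton f n h (suc h) (ℕ.n<1+n h))) (cancel (f n) _)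

    D-congruence-≤ : ∀ s t {m n} → n ≤ m → + (p ^ s) ℤᵘ.∣ + m ℤ.- + n →
                     + (p ^ (s ∸ t)) ℤˢ.∣ D (suc t) m ℤ.- D (suc t) n
    D-congruence-≤ s t {m} {n} n≤m p^s∣m-n =
      subst (λ m → + (p ^ (s ∸ t)) ℤˢ.∣ D (suc t) m ℤ.- D (suc t) n) (ℕ.m+[n∸m]≡n n≤m)
        (D-congruence-+ s t n (m ∸ n) (subst (p ^ s ∣_) (∣[+m]-[+n]∣≡m∸n n≤m) p^s∣m-n))

    D-congruence : ∀ s t m n → + (p ^ s) ℤᵘ.∣ + m ℤ.- + n → + (p ^ (s ∸ t)) ℤˢ.∣ D (suc t) m ℤ.- D (suc t) n
    D-congruence s t m n p^s∣m-n with ℕ.≤-total n m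
    ... | inj₁ n≤m = D-congruence-≤ s t n≤m p^s∣m-n
    ... | inj₂ m≤n = subst (+ (p ^ (s ∸ t)) ℤˢ.∣_) (swap (D (suc t) n) (D (suc t) m))
                       (ℤˢ.∣m⇒∣-m (D-congruence-≤ s t m≤n (subst (p ^ s ∣_) (ℤ.∣i-j∣≡∣j-i∣ (+ m) (+ n)) p^s∣m-n)))
      where
      swap : ∀ x y → ℤ.- (x ℤ.- y) ≡ y ℤ.- x
      swap = ℤ-Solver.solve-∀

open import Defs
open import Data.Nat using (ℕ; suc; _∸_; _^_; _<_; NonZero)
open import Data.Nat.Primality using (Prime)
open import Data.Integer using (+_; _-_)
open import Data.Integer.Divisibility using (_∣_)
open import Relation.Binary.PropositionalEquality using (subst₂; sym)
open IntegerEmbedding using (∣-⇒≡[modℚ])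
open ChebyshevCoefficients using (D; d≡ιD)
open Congruence using (D-congruence)

proposition2p3 : (ℓ : ℕ) → Prime ℓ → (m n s : ℕ) → NonZero m → NonZero n → NonZero s
    → (+ (ℓ ^ s)) ∣ ((+ m) - (+ n))
    → (t : ℕ) → t < s
    → d (suc t) m ≡ d (suc t) n [modℚ (ℓ ^ (s ∸ t)) ]
proposition2p3 ℓ ℓ-prime m n s _ _ _ ℓ^s∣m-n t _ =
  subst₂ (λ x y → x ≡ y [modℚ ℓ ^ (s ∸ t) ]) (sym (d≡ιD (suc t) m)) (sym (d≡ιD (suc t) n))
    (∣-⇒≡[modℚ] (D (suc t) m) (D (suc t) n) (D-congruence ℓ-prime s t m n ℓ^s∣m-n))
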